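{- Let $r,s$ be distinct positive integers with $\gcd(r,s)=1$, let $R=\{r\}$, $S=\{s\}$, and let $I$ be a finite subset of $\mathbb{Z}^+\setminus(R\cup S)$. Then \[\lim_{n\to\infty}\frac{p_{R>S,I}(n)}{p_{RSI}(n)}=\frac{s}{r+s}.\]
   Context: For pairwise disjoint sets $R,S,I\subseteq\mathbb{Z}^+$, $p_{RSI}(n)$ denotes the number of partitions of $n$ all of whose parts lie in $R\cup S\cup I$, and $p_{R>S,I}(n)$ denotes the number of those partitions in which the number of parts lying in $R$ (counted with multiplicity) is strictly greater than the number of parts lying in $S$ (counted with multiplicity). -}

module Defs where

open import Data.Nat.Base using (ℕ; zero; suc; _+_; _≤ᵇ_; _<ᵇ_; _≡ᵇ_)
open import Data.Bool.Base using (Bool; true; false; _∧_; _∨_)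
open import Data.List.Base using (List; []; _∷_; map; concatMap; upTo; length; filterᵇ)
open import Data.Nat.ListAction using (sum)
open import Data.Bool.ListAction using (any; all)

boundedLists : ℕ → ℕ → List (List ℕ)
boundedLists zero    m = [] ∷ []
boundedLists (suc k) m =
  [] ∷ concatMap (λ x → map (x ∷_) (boundedLists k m)) (map suc (upTo m))

nonincreasing : List ℕ → Bool
nonincreasing []           = true
nonincreasing (x ∷ [])     = true
nonincreasing (x ∷ y ∷ xs) = (y ≤ᵇ x) ∧ nonincreasing (y ∷ xs)

-- A partition of n: a nonincreasing list of positive integers summing to n.
-- Every such list has length ≤ n and entries ≤ n, so this enumerates all
-- partitions of n, each exactly once.
partitions : ℕ → List (List ℕ)
partitions n = filterᵇ (λ l → (sum l ≡ᵇ n) ∧ nonincreasing l) (boundedLists n n)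

memᵇ : ℕ → List ℕ → Bool
memᵇ x xs = any (λ y → x ≡ᵇ y) xs

countPart : ℕ → List ℕ → ℕ
countPart a l = length (filterᵇ (λ x → x ≡ᵇ a) l)

allowed : ℕ → ℕ → List ℕ → List ℕ → Bool
allowed r s I l = all (λ x → (x ≡ᵇ r) ∨ ((x ≡ᵇ s) ∨ memᵇ x I)) l

pRSI : ℕ → ℕ → List ℕ → ℕ → ℕ
pRSI r s I n = length (filterᵇ (allowed r s I) (partitions n))

pR>S : ℕ → ℕ → List ℕ → ℕ → ℕ
pR>S r s I n =
  length (filterᵇ (λ l → allowed r s I l ∧ (countPart s l <ᵇ countPart r l)) (partitions n))

private
  open import Relation.Binary.PropositionalEquality using (_≡_; refl)
  t1 : length (partitions 5) ≡ 7
  t1 = refl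
  t2 : pRSI 2 1 [] 5 ≡ 3
  t2 = refl
  t3 : pR>S 2 1 [] 5 ≡ 1
  t3 = refl

-- Write pTotal A n and pMoreR A n for the number of partitions of n into parts from A, and for
-- those among them with more parts r than parts s. For A = {r, s} a partition is determined by
-- its number of r's, so pTotal(n) = Σⱼ U(n - j r) where U is the indicator of multiples of s;
-- likewise the partitions with at most as many r's as s's number Σⱼ U(n - j (r + s)), since
-- removing one r and one s maps them bijectively onto the smaller ones. As r and r + s are
-- coprime to s, any s consecutive terms of either sum contain exactly one 1, so over the period
-- P = (r + s) s r the two counts grow by exactly r + s and r. Hence (r + s) pMoreR - s pTotal,
-- which equals r pTotal - (r + s) (pTotal - pMoreR), is periodic and bounded, while pTotal → ∞.
-- Allowing one more part v ∉ {r, s} replaces both counts by their stride-v sums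
-- f′(n) = f(n) + f′(n - v). The error |(r + s) pMoreR - s pTotal| is subadditive along the same
-- recursion, and an error eventually below pTotal / K stays below it, up to an additive
-- constant, after summation. Induction over I finishes the proof.

module Submission where

open import Defs
open import Data.Nat.Base using (ℕ; suc; _+_; _*_; _≤_; _<_; ∣_-_∣)
open import Data.Nat.GCD using (gcd)
open import Data.List.Base using (List)
open import Data.List.Relation.Unary.All using (All)
open import Data.Product using (∃-syntax; _×_)
open import Relation.Binary.PropositionalEquality using (_≡_; _≢_)

open import Algebra.Bundles using (CommutativeMonoid)
open import Data.Bool.Base using (Bool; true; false; T; _∧_; _∨_; not)
open import Data.Bool.ListAction using (all; and)
open import Data.Bool.Properties
  using (T-∧; ∧-assoc; ∧-comm; ∧-identityʳ; ∧-zeroʳ; ∨-identityʳ; ∧-commutativeMonoid; ∨-commutativeMonoid)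
open import Data.Fin.Base using (Fin; toℕ; fromℕ<; punchIn)
open import Data.Fin.Properties using (toℕ-fromℕ<; toℕ-injective; toℕ<n; punchInᵢ≢i)
open import Data.List.Base
  using ([]; _∷_; _++_; map; concatMap; upTo; length; filterᵇ; cartesianProductWith)
open import Data.List.Membership.Propositional using (_∈_)
open import Data.List.Membership.Propositional.Properties
  using ( ∈-map⁺; ∈-map⁻; ∈-upTo⁺; ∈-filter⁺; ∈-filter⁻; ∈-∃++
        ; ∈-cartesianProductWith⁺; ∈-cartesianProductWith⁻)
open import Data.List.Membership.Propositional.Properties.WithK using (unique∧set⇒bag)
open import Data.List.Properties using (∷-injective; length-map; map-cong; filter-none; filter-≐)
open import Data.List.Relation.Binary.BagAndSetEquality using (∼bag⇒↭)
open import Data.List.Relation.Binary.Permutation.Propositional using (_↭_; ↭-sym; ↭-trans; prep; ↭⇒↭ₛ)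
open import Data.List.Relation.Binary.Permutation.Propositional.Properties
  using (↭-length; All-resp-↭; ∈-resp-↭; drop-∷; shift; filter-↭; map⁺)
open import Data.List.Relation.Binary.Permutation.Setoid.Properties using (foldr-commMonoid)
open import Data.List.Relation.Binary.Pointwise using (Pointwise-≡⇒≡)
open import Data.List.Relation.Unary.All as All using ([]; _∷_)
import Data.List.Relation.Unary.All.Properties as All
open import Data.List.Relation.Unary.AllPairs using ([]; _∷_)
open import Data.List.Relation.Unary.Any as Any using (here; there)
open import Data.List.Relation.Unary.Any.Properties using (any⁺; any⁻)
open import Data.List.Relation.Unary.Linked using ([]; [-]; _∷_)
open import Data.List.Relation.Unary.Sorted.TotalOrder.Properties using (↗↭↗⇒≋)
open import Data.List.Relation.Unary.Unique.Propositional using (Unique)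
import Data.List.Relation.Unary.Unique.Propositional.Properties as Unique
open import Data.Nat.Base using (zero; pred; _∸_; _⊔_; _<ᵇ_; _≡ᵇ_; z≤n; s≤s; z<s; NonZero; >-nonZero)
open import Data.Nat.Coprimality as Coprime using (Coprime; coprime-Bézout; coprime-divisor; coprime-+; gcd≡1⇒coprime)
open import Data.Nat.DivMod using (_%_; _/_; m≡m%n+[m/n]*n; m%n<n)
open import Data.Nat.Divisibility
  using (_∣_; _∤_; divides; _∣0; ∣-refl; ∣m+n∣m⇒∣n; ∣m∣n⇒∣m+n; ∣n⇒∣m*n; n∣m*n; ∣⇒≤)
open import Data.Nat.GCD using (module Bézout)
open import Data.Nat.Induction using (<-rec)
open import Data.Nat.ListAction using (sum)
open import Data.Nat.ListAction.Properties using (sum-↭)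
open import Data.Nat.Properties
open import Data.Nat.Solver using (module +-*-Solver)
open import Data.Product using (_,_; proj₁; proj₂; map₂)
open import Data.Sum using (inj₁; inj₂)
open import Data.Vec.Functional using (removeAt; replicate)
open import Function.Base using (_∘_)
open import Function.Bundles using (_⇔_; mk⇔; Equivalence)
open import Relation.Binary.Core using (_Preserves_⟶_)
open import Relation.Binary.Properties.DecTotalOrder ≤-decTotalOrder using (≥-decTotalOrder; ≥-totalOrder)
open import Relation.Binary.PropositionalEquality
  using (_≗_; refl; sym; trans; cong; cong₂; subst; subst₂; module ≡-Reasoning)
open import Relation.Nullary using (¬_; yes; no; contradiction)
open import Relation.Nullary.Decidable using (T?)

open import Algebra.Properties.CommutativeMonoid.Sum +-0-commutativeMonoid
  using (sum-syntax; sum-remove; sum-cong-≗; sum-replicate-zero)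
open import Algebra.Properties.CommutativeSemigroup (CommutativeMonoid.commutativeSemigroup ∨-commutativeMonoid)
  using (x∙yz≈y∙xz)
open import Data.List.Relation.Unary.Sorted.TotalOrder ≥-totalOrder using (Sorted)
open import Data.List.Sort.InsertionSort ≥-decTotalOrder using (insert; sort)
open import Data.List.Sort.InsertionSort.Properties ≥-decTotalOrder using (insert-↭; insert-↗; sort-↭; sort-↗)
open +-*-Solver using (solve; _:+_; _:*_; _:=_; con)

private
  variable
    d d′ f g Z Z′ : ℕ → ℕ

-- Eventual behaviour of sequences

Eventually : (ℕ → Set) → Set
Eventually P = ∃[ N ] (∀ n → N ≤ n → P n)

eventually-mono : ∀ {P Q : ℕ → Set} → (∀ n → P n → Q n) → Eventually P → Eventually Q
eventually-mono P⇒Q (N , P-from-N) = N , λ n N≤n → P⇒Q n (P-from-N n N≤n)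

Unbounded : (ℕ → ℕ) → Set
Unbounded f = ∀ M → Eventually (λ n → M ≤ f n)

Negligible : (ℕ → ℕ) → (ℕ → ℕ) → Set
Negligible d Z = ∀ K → Eventually (λ n → K * d n ≤ Z n)

unbounded-mono : (∀ n → f n ≤ g n) → Unbounded f → Unbounded g
unbounded-mono f≤g f→∞ M = eventually-mono (λ n M≤fn → ≤-trans M≤fn (f≤g n)) (f→∞ M)

initial-segment-bounded : ∀ (f : ℕ → ℕ) N → ∃[ B ] (∀ n → n < N → f n ≤ B)
initial-segment-bounded f zero    = 0 , λ _ ()
initial-segment-bounded f (suc N) with B , below ← initial-segment-bounded f N = B ⊔ f N , bound
  where
  bound : ∀ n → n < suc N → f n ≤ B ⊔ f N
  bound n n<1+N with m<1+n⇒m<n∨m≡n n<1+N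
  ... | inj₁ n<N  = ≤-trans (below n n<N) (m≤m⊔n B (f N))
  ... | inj₂ refl = m≤n⊔m B (f N)

periodic⇒bounded : ∀ P .{{_ : NonZero P}} (f : ℕ → ℕ) → (∀ n → f (P + n) ≡ f n) → ∃[ B ] (∀ n → f n ≤ B)
periodic⇒bounded P f periodic with B , below ← initial-segment-bounded f P =
  B , λ n → subst (_≤ B) (f-mod n) (below (n % P) (m%n<n n P))
  where
  f-iterate : ∀ t m → f (t * P + m) ≡ f m
  f-iterate zero    m = refl
  f-iterate (suc t) m = trans (cong f (+-assoc P (t * P) m)) (trans (periodic (t * P + m)) (f-iterate t m))
  f-mod : ∀ n → f (n % P) ≡ f n
  f-mod n = trans (sym (f-iterate (n / P) (n % P))) (cong f (trans (+-comm _ (n % P)) (sym (m≡m%n+[m/n]*n n P))))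

quasiperiodic⇒unbounded : ∀ {P f} → (∀ t n → f (t * P + n) ≡ t + f n) → Unbounded f
quasiperiodic⇒unbounded {P} {f} f-shift M = M * P , λ n M*P≤n → begin
  M                           ≤⟨ m≤m+n M _ ⟩
  M + f (n ∸ M * P)           ≡⟨ sym (f-shift M (n ∸ M * P)) ⟩
  f (M * P + (n ∸ M * P))     ≡⟨ cong f (m+[n∸m]≡n M*P≤n) ⟩
  f n                         ∎
  where open ≤-Reasoning

∣-∣-periodic : ∀ p q (f g : ℕ → ℕ) {P a b} → (∀ n → f (P + n) ≡ a + f n) → (∀ n → g (P + n) ≡ b + g n) →
               p * a ≡ q * b → ∀ n → ∣ p * f (P + n) - q * g (P + n) ∣ ≡ ∣ p * f n - q * g n ∣
∣-∣-periodic p q f g {P} {a} {b} f-shift g-shift pa≡qb n = begin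
  ∣ p * f (P + n) - q * g (P + n) ∣       ≡⟨ cong₂ (λ x y → ∣ p * x - q * y ∣) (f-shift n) (g-shift n) ⟩
  ∣ p * (a + f n) - q * (b + g n) ∣       ≡⟨ cong₂ ∣_-_∣ (*-distribˡ-+ p a (f n)) (*-distribˡ-+ q b (g n)) ⟩
  ∣ p * a + p * f n - q * b + q * g n ∣   ≡⟨ cong (λ x → ∣ p * a + p * f n - x + q * g n ∣) (sym pa≡qb) ⟩
  ∣ p * a + p * f n - p * a + q * g n ∣   ≡⟨ ∣m+n-m+o∣≡∣n-o∣ (p * a) (p * f n) (q * g n) ⟩
  ∣ p * f n - q * g n ∣                   ∎
  where open ≡-Reasoning

bounded⇒negligible : ∀ {B} → (∀ n → d n ≤ B) → Unbounded Z → Negligible d Z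
bounded⇒negligible {B = B} d≤B Z→∞ K = eventually-mono (λ n → ≤-trans (*-monoʳ-≤ K (d≤B n))) (Z→∞ (K * B))

negligible⇒eventually-< : Negligible d Z → Unbounded Z → ∀ k → Eventually (λ n → suc k * d n < Z n)
negligible⇒eventually-< {d} {Z} d≪Z Z→∞ k with N₁ , small ← d≪Z (suc (suc k)) | N₂ , positive ← Z→∞ 1 =
  N₁ ⊔ N₂ , λ n N≤n →
    strict (d n) (small n (≤-trans (m≤m⊔n N₁ N₂) N≤n)) (positive n (≤-trans (m≤n⊔m N₁ N₂) N≤n))
  where
  strict : ∀ x {z} → suc (suc k) * x ≤ z → 0 < z → suc k * x < z
  strict zero    {z} _  0<z = subst (_< z) (sym (*-zeroʳ (suc k))) 0<z
  strict (suc x)     le _   = <-≤-trans (m<n+m (suc k * suc x) z<s) le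

-- Stride sums

-- f n ∼ g n + g (n ∸ v) + g (n ∸ 2v) + ⋯ ; on generating functions, f = g / (1 - xᵛ)
record StrideSum (_∼_ : ℕ → ℕ → Set) (v : ℕ) (g f : ℕ → ℕ) : Set where
  field
    initial : ∀ n → n < v → f n ∼ g n
    step    : ∀ n → f (v + n) ∼ (g (v + n) + f n)

stride-induction : ∀ {ℓ} (P : ℕ → Set ℓ) {v} → 0 < v →
                   (∀ n → n < v → P n) → (∀ n → P n → P (v + n)) → ∀ n → P n
stride-induction P {v} v>0 initial step = <-rec P go
  where
  go : ∀ n → (∀ {m} → m < n → P m) → P n
  go n rec with n <? v
  ... | yes n<v = initial n n<v
  ... | no  n≮v = subst P (m+[n∸m]≡n (≮⇒≥ n≮v)) (step (n ∸ v) (rec (∸-monoʳ-< v>0 (≮⇒≥ n≮v))))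

∣m+n-o+p∣≤∣m-o∣+∣n-p∣ : ∀ m n o p → ∣ m + n - o + p ∣ ≤ ∣ m - o ∣ + ∣ n - p ∣
∣m+n-o+p∣≤∣m-o∣+∣n-p∣ m n o p = begin
  ∣ m + n - o + p ∣                     ≤⟨ ∣-∣-triangle (m + n) (o + n) (o + p) ⟩
  ∣ m + n - o + n ∣ + ∣ o + n - o + p ∣ ≡⟨ cong (_+ ∣ o + n - o + p ∣) (cong₂ ∣_-_∣ (+-comm m n) (+-comm o n)) ⟩
  ∣ n + m - n + o ∣ + ∣ o + n - o + p ∣ ≡⟨ cong₂ _+_ (∣m+n-m+o∣≡∣n-o∣ n m o) (∣m+n-m+o∣≡∣n-o∣ o n p) ⟩
  ∣ m - o ∣ + ∣ n - p ∣                 ∎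
  where open ≤-Reasoning

module _ {v : ℕ} where

  strideSum-≥ : 0 < v → StrideSum _≡_ v g f → ∀ n → g n ≤ f n
  strideSum-≥ {g} {f} v>0 f≡Σg = stride-induction (λ n → g n ≤ f n) v>0
    (λ n n<v → ≤-reflexive (sym (initial n n<v)))
    (λ n _ → subst (g (v + n) ≤_) (sym (step n)) (m≤m+n _ _))
    where open StrideSum f≡Σg

  strideSum-scale : ∀ p → StrideSum _≡_ v g f → StrideSum _≡_ v (λ n → p * g n) (λ n → p * f n)
  strideSum-scale {g} {f} p f≡Σg = record
    { initial = λ n n<v → cong (p *_) (initial n n<v)
    ; step    = λ n → trans (cong (p *_) (step n)) (*-distribˡ-+ p (g (v + n)) (f n))
    }
    where open StrideSum f≡Σg

  strideSum-distance : ∀ {g′ f′} → StrideSum _≡_ v g f → StrideSum _≡_ v g′ f′ →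
                       StrideSum _≤_ v (λ n → ∣ g n - g′ n ∣) (λ n → ∣ f n - f′ n ∣)
  strideSum-distance {g} {f} {g′} {f′} f≡Σg f′≡Σg′ = record
    { initial = λ n n<v → ≤-reflexive (cong₂ ∣_-_∣ (F.initial n n<v) (F′.initial n n<v))
    ; step    = λ n → subst (_≤ ∣ g (v + n) - g′ (v + n) ∣ + ∣ f n - f′ n ∣)
                        (sym (cong₂ ∣_-_∣ (F.step n) (F′.step n)))
                        (∣m+n-o+p∣≤∣m-o∣+∣n-p∣ (g (v + n)) (f n) (g′ (v + n)) (f′ n))
    }
    where
    module F  = StrideSum f≡Σg
    module F′ = StrideSum f′≡Σg′

  -- Below N the error is absorbed into the constant K * B; from N on, K * d ≤ Z is summed along the stride.
  strideSum-error : 0 < v → StrideSum _≤_ v d d′ → StrideSum _≡_ v Z Z′ → ∀ {K N B} →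
                    (∀ n → N ≤ n → K * d n ≤ Z n) → (∀ n → n < N → d′ n ≤ B) →
                    ∀ n → K * d′ n ≤ Z′ n + K * B
  strideSum-error {d} {d′} {Z} {Z′} v>0 d′≤Σd Z′≡ΣZ {K} {N} {B} small d′≤B =
    stride-induction P v>0
      (λ n n<v → from-N n λ N≤n → begin
        K * d′ n        ≤⟨ *-monoʳ-≤ K (D′.initial n n<v) ⟩
        K * d n         ≤⟨ small n N≤n ⟩
        Z n             ≡⟨ sym (Z′.initial n n<v) ⟩
        Z′ n            ≤⟨ m≤m+n (Z′ n) (K * B) ⟩
        Z′ n + K * B    ∎)
      (λ n P[n] → from-N (v + n) λ N≤v+n → begin
        K * d′ (v + n)                 ≤⟨ *-monoʳ-≤ K (D′.step n) ⟩
        K * (d (v + n) + d′ n)         ≡⟨ *-distribˡ-+ K (d (v + n)) (d′ n) ⟩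
        K * d (v + n) + K * d′ n       ≤⟨ +-mono-≤ (small (v + n) N≤v+n) P[n] ⟩
        Z (v + n) + (Z′ n + K * B)     ≡⟨ sym (+-assoc (Z (v + n)) (Z′ n) (K * B)) ⟩
        Z (v + n) + Z′ n + K * B       ≡⟨ cong (_+ K * B) (sym (Z′.step n)) ⟩
        Z′ (v + n) + K * B             ∎)
    where
    open ≤-Reasoning
    module D′ = StrideSum d′≤Σd
    module Z′ = StrideSum Z′≡ΣZ
    P : ℕ → Set
    P n = K * d′ n ≤ Z′ n + K * B
    from-N : ∀ n → (N ≤ n → P n) → P n
    from-N n P[n] with n <? N
    ... | yes n<N = ≤-trans (*-monoʳ-≤ K (d′≤B n n<N)) (m≤n+m (K * B) (Z′ n))
    ... | no  n≮N = P[n] (≮⇒≥ n≮N)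

  negligible-strideSum : 0 < v → StrideSum _≤_ v d d′ → StrideSum _≡_ v Z Z′ →
                         Negligible d Z → Unbounded Z → Negligible d′ Z′
  negligible-strideSum {d} {d′} {Z} {Z′} v>0 d′≤Σd Z′≡ΣZ d≪Z Z→∞ K
    with N , small ← d≪Z (2 * K)
    with B , d′≤B ← initial-segment-bounded d′ N
    with N′ , big ← unbounded-mono (strideSum-≥ v>0 Z′≡ΣZ) Z→∞ (2 * K * B) =
    N′ , λ n N′≤n → *-cancelˡ-≤ 2 (begin
      2 * (K * d′ n)       ≡⟨ sym (*-assoc 2 K (d′ n)) ⟩
      2 * K * d′ n         ≤⟨ strideSum-error v>0 d′≤Σd Z′≡ΣZ {K = 2 * K} small d′≤B n ⟩
      Z′ n + 2 * K * B     ≤⟨ +-monoʳ-≤ (Z′ n) (big n N′≤n) ⟩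
      Z′ n + Z′ n          ≡⟨ cong (Z′ n +_) (sym (+-identityʳ (Z′ n))) ⟩
      2 * Z′ n             ∎)
    where open ≤-Reasoning

-- X n / Y n → q / p
record RatioTendsTo (q p : ℕ) (X Y : ℕ → ℕ) : Set where
  constructor _,_
  field
    error-negligible : Negligible (λ n → ∣ p * X n - q * Y n ∣) (λ n → p * Y n)
    denominator-unbounded : Unbounded (λ n → p * Y n)

module _ {q p : ℕ} {X Y : ℕ → ℕ} where

  ratio-cong : ∀ {X′ Y′} → X ≗ X′ → Y ≗ Y′ → RatioTendsTo q p X Y → RatioTendsTo q p X′ Y′
  ratio-cong X≗X′ Y≗Y′ (d≪Z , Z→∞) =
    (λ K → eventually-mono (λ n → subst₂ (λ x y → K * ∣ p * x - q * y ∣ ≤ p * y) (X≗X′ n) (Y≗Y′ n)) (d≪Z K)) ,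
    (λ M → eventually-mono (λ n → subst (λ y → M ≤ p * y) (Y≗Y′ n)) (Z→∞ M))

  ratio-strideSum : ∀ {v X′ Y′} → 0 < v → StrideSum _≡_ v X X′ → StrideSum _≡_ v Y Y′ →
                    RatioTendsTo q p X Y → RatioTendsTo q p X′ Y′
  ratio-strideSum v>0 X′≡ΣX Y′≡ΣY (d≪Z , Z→∞) =
    negligible-strideSum v>0 (strideSum-distance (strideSum-scale p X′≡ΣX) (strideSum-scale q Y′≡ΣY)) pY′≡ΣpY d≪Z Z→∞ ,
    unbounded-mono (strideSum-≥ v>0 pY′≡ΣpY) Z→∞
    where pY′≡ΣpY = strideSum-scale p Y′≡ΣY

  ratio⇒eventually : RatioTendsTo q p X Y → ∀ k → Eventually (λ n → suc k * ∣ p * X n - q * Y n ∣ < p * Y n)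
  ratio⇒eventually (d≪Z , Z→∞) = negligible⇒eventually-< d≪Z Z→∞

-- Residues of an arithmetic progression

IndicatesMultiples : ℕ → (ℕ → ℕ) → Set
IndicatesMultiples s U = ∀ m → (s ∣ m → U m ≡ 1) × (s ∤ m → U m ≡ 0)

m<n⇒n∣m⇒m≡0 : ∀ {m n} → m < n → n ∣ m → m ≡ 0
m<n⇒n∣m⇒m≡0 {zero}  _   _   = refl
m<n⇒n∣m⇒m≡0 {suc m} m<n n∣m = contradiction (∣⇒≤ n∣m) (<⇒≱ m<n)

module _ {s c : ℕ} (coprime : Coprime s c) where

  negated-inverse : .{{_ : NonZero s}} → ∃[ a ] s ∣ a * c + 1
  negated-inverse with coprime-Bézout coprime
  ... | Bézout.+- x y 1+yc≡xs = y , divides x (trans (+-comm (y * c) 1) 1+yc≡xs)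
  ... | Bézout.-+ x y 1+xs≡yc = s′ * y , divides (1 + s′ * x) (begin
    s′ * y * c + 1              ≡⟨ solve 3 (λ s′ y c → s′ :* y :* c :+ con 1 := s′ :* (y :* c) :+ con 1) refl s′ y c ⟩
    s′ * (y * c) + 1            ≡⟨ cong (λ t → s′ * t + 1) (sym 1+xs≡yc) ⟩
    s′ * (1 + x * s) + 1        ≡⟨ cong (λ t → s′ * (1 + x * t) + 1) (sym (suc-pred s)) ⟩
    s′ * (1 + x * suc s′) + 1   ≡⟨ solve 2 (λ s′ x → s′ :* (con 1 :+ x :* (con 1 :+ s′)) :+ con 1
                                                  := (con 1 :+ s′ :* x) :* (con 1 :+ s′)) refl s′ x ⟩
    (1 + s′ * x) * suc s′       ≡⟨ cong ((1 + s′ * x) *_) (suc-pred s) ⟩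
    (1 + s′ * x) * s            ∎)
    where
    open ≡-Reasoning
    s′ = pred s

  residue-exists : .{{_ : NonZero s}} → ∀ X → ∃[ i ] (i < s × s ∣ i * c + X)
  residue-exists X with a , s∣ac+1 ← negated-inverse =
    i , m%n<n (X * a) s , ∣m+n∣m⇒∣n (subst (s ∣_) eq (∣n⇒∣m*n X s∣ac+1)) (n∣m*n (q * c))
    where
    i = (X * a) % s
    q = (X * a) / s
    eq : X * (a * c + 1) ≡ q * c * s + (i * c + X)
    eq = begin
      X * (a * c + 1)          ≡⟨ solve 3 (λ X a c → X :* (a :* c :+ con 1) := X :* a :* c :+ X) refl X a c ⟩
      X * a * c + X            ≡⟨ cong (λ t → t * c + X) (m≡m%n+[m/n]*n (X * a) s) ⟩
      (i + q * s) * c + X      ≡⟨ solve 5 (λ i q s c X → (i :+ q :* s) :* c :+ X := q :* c :* s :+ (i :* c :+ X)) refl i q s c X ⟩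
      q * c * s + (i * c + X)  ∎
      where open ≡-Reasoning

  private
    residue-unique-≤ : ∀ {X i j} → i ≤ j → j < s → s ∣ i * c + X → s ∣ j * c + X → i ≡ j
    residue-unique-≤ {X} {i} {j} i≤j j<s s∣i s∣j =
      ≤-antisym i≤j (m∸n≡0⇒m≤n (m<n⇒n∣m⇒m≡0 (≤-<-trans (m∸n≤m j i) j<s) s∣j∸i))
      where
      eq : j * c + X ≡ (i * c + X) + c * (j ∸ i)
      eq = begin
        j * c + X                  ≡⟨ cong (λ t → t * c + X) (sym (m∸n+n≡m i≤j)) ⟩
        (j ∸ i + i) * c + X        ≡⟨ solve 4 (λ k i c X → (k :+ i) :* c :+ X := (i :* c :+ X) :+ c :* k) refl (j ∸ i) i c X ⟩
        (i * c + X) + c * (j ∸ i)  ∎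
        where open ≡-Reasoning
      s∣j∸i : s ∣ j ∸ i
      s∣j∸i = coprime-divisor coprime (∣m+n∣m⇒∣n (subst (s ∣_) eq s∣j) s∣i)

  residue-unique : ∀ {X i j} → i < s → j < s → s ∣ i * c + X → s ∣ j * c + X → i ≡ j
  residue-unique i<s j<s s∣i s∣j with ≤-total _ _
  ... | inj₁ i≤j = residue-unique-≤ i≤j j<s s∣i s∣j
  ... | inj₂ j≤i = sym (residue-unique-≤ j≤i i<s s∣j s∣i)

∑-indicator-residues : ∀ {s c U} .{{_ : NonZero s}} → Coprime s c → IndicatesMultiples s U →
                       ∀ X → ∑[ i < s ] U (toℕ i * c + X) ≡ 1
∑-indicator-residues {suc s′} {c} {U} coprime U≡[s∣] X = single-hit (residue-exists coprime X)
  where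
  term : Fin (suc s′) → ℕ
  term j = U (toℕ j * c + X)
  single-hit : ∃[ i ] (i < suc s′ × suc s′ ∣ i * c + X) → ∑[ j < suc s′ ] term j ≡ 1
  single-hit (i , i<s , s∣) = begin
    ∑[ j < suc s′ ] term j                 ≡⟨ sum-remove {i = k} term ⟩
    term k + ∑[ j < s′ ] removeAt term k j ≡⟨ cong₂ _+_ hit (trans (sum-cong-≗ miss) (sum-replicate-zero s′)) ⟩
    1 + 0                                  ∎
    where
    open ≡-Reasoning
    k = fromℕ< i<s
    hit : term k ≡ 1
    hit = proj₁ (U≡[s∣] _) (subst (λ t → suc s′ ∣ t * c + X) (sym (toℕ-fromℕ< i<s)) s∣)
    miss : removeAt term k ≗ replicate s′ 0
    miss j = proj₂ (U≡[s∣] _) λ s∣′ → punchInᵢ≢i k j (toℕ-injective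
      (trans (residue-unique coprime (toℕ<n (punchIn k j)) i<s s∣′ s∣) (sym (toℕ-fromℕ< i<s))))

strideSum-telescope : ∀ {c g f} → StrideSum _≡_ c g f →
                      ∀ t n → f (t * c + n) ≡ f n + ∑[ i < t ] g (toℕ i * c + (c + n))
strideSum-telescope {c} {g} {f} f≡Σg zero    n = sym (+-identityʳ (f n))
strideSum-telescope {c} {g} {f} f≡Σg (suc t) n = begin
  f ((c + t * c) + n)                                          ≡⟨ cong f (rotate (t * c) n) ⟩
  f (t * c + (c + n))                                          ≡⟨ strideSum-telescope f≡Σg t (c + n) ⟩
  f (c + n) + rest                                             ≡⟨ cong (_+ rest) (StrideSum.step f≡Σg n) ⟩
  (g (c + n) + f n) + rest                                     ≡⟨ +-assoc-comm (g (c + n)) (f n) rest ⟩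
  f n + (g (c + n) + rest)                                     ≡⟨ cong (λ x → f n + (g (c + n) + x)) (sum-cong-≗ shifted) ⟩
  f n + ∑[ i < suc t ] g (toℕ i * c + (c + n))                 ∎
  where
  open ≡-Reasoning
  rest = ∑[ i < t ] g (toℕ i * c + (c + (c + n)))
  +-assoc-comm : ∀ a b x → (a + b) + x ≡ b + (a + x)
  +-assoc-comm a b x = trans (cong (_+ x) (+-comm a b)) (+-assoc b a x)
  rotate : ∀ x y → (c + x) + y ≡ x + (c + y)
  rotate x y = +-assoc-comm c x y
  shifted : (λ i → g (toℕ i * c + (c + (c + n)))) ≗ (λ (i : Fin t) → g (suc (toℕ i) * c + (c + n)))
  shifted i = cong g (sym (rotate (toℕ i * c) (c + n)))

strideSum-period : ∀ {s c U W} .{{_ : NonZero s}} → Coprime s c → IndicatesMultiples s U → StrideSum _≡_ c U W →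
                   ∀ t n → W (t * (s * c) + n) ≡ t + W n
strideSum-period coprime U≡[s∣] W≡ΣU zero    n = refl
strideSum-period {s} {c} {U} {W} coprime U≡[s∣] W≡ΣU (suc t) n = begin
  W ((s * c + t * (s * c)) + n)              ≡⟨ cong W (+-assoc (s * c) _ n) ⟩
  W (s * c + m)                              ≡⟨ strideSum-telescope W≡ΣU s m ⟩
  W m + ∑[ i < s ] U (toℕ i * c + (c + m))   ≡⟨ cong (W m +_) (∑-indicator-residues coprime U≡[s∣] (c + m)) ⟩
  W m + 1                                    ≡⟨ +-comm (W m) 1 ⟩
  suc (W m)                                  ≡⟨ cong suc (strideSum-period coprime U≡[s∣] W≡ΣU t n) ⟩
  suc t + W n                                ∎
  where
  open ≡-Reasoning
  m = t * (s * c) + n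

-- Enumerating partitions

boundedLists≡ : ∀ k m → boundedLists (suc k) m ≡ [] ∷ cartesianProductWith _∷_ (map suc (upTo m)) (boundedLists k m)
boundedLists≡ k m = cong ([] ∷_) (go (map suc (upTo m)))
  where
  go : ∀ xs → concatMap (λ x → map (x ∷_) (boundedLists k m)) xs ≡ cartesianProductWith _∷_ xs (boundedLists k m)
  go []       = refl
  go (x ∷ xs) = cong (map (x ∷_) (boundedLists k m) ++_) (go xs)

∈-boundedLists⁺ : ∀ {k m l} → length l ≤ k → All (λ x → 0 < x × x ≤ m) l → l ∈ boundedLists k m
∈-boundedLists⁺ {zero}  {l = []} _ _ = here refl
∈-boundedLists⁺ {suc k} {l = []} _ _ = here refl
∈-boundedLists⁺ {suc k} {m} {suc x ∷ l} (s≤s l≤k) ((_ , x<m) ∷ bounds) rewrite boundedLists≡ k m =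
  there (∈-cartesianProductWith⁺ _∷_ (∈-map⁺ suc (∈-upTo⁺ x<m)) (∈-boundedLists⁺ l≤k bounds))

∈-boundedLists⁻ : ∀ {k m l} → l ∈ boundedLists k m → All (0 <_) l
∈-boundedLists⁻ {zero}  (here refl) = []
∈-boundedLists⁻ {suc k} {m} l∈ rewrite boundedLists≡ k m with l∈
... | here refl = []
... | there l∈′ with x , l , x∈ , l∈ , refl ← ∈-cartesianProductWith⁻ _∷_ (map suc (upTo m)) (boundedLists k m) l∈′
                 with y , _ , refl ← ∈-map⁻ suc x∈ = s≤s z≤n ∷ ∈-boundedLists⁻ l∈

boundedLists-unique : ∀ k m → Unique (boundedLists k m)
boundedLists-unique zero    m = [] ∷ []
boundedLists-unique (suc k) m rewrite boundedLists≡ k m =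
  All.tabulate nonempty ∷ Unique.cartesianProductWith⁺ _∷_ ∷-injective
    (Unique.map⁺ suc-injective (Unique.upTo⁺ m)) (boundedLists-unique k m)
  where
  nonempty : ∀ {l} → l ∈ cartesianProductWith _∷_ (map suc (upTo m)) (boundedLists k m) → [] ≢ l
  nonempty l∈ with _ , _ , _ , _ , refl ← ∈-cartesianProductWith⁻ _∷_ (map suc (upTo m)) (boundedLists k m) l∈ = λ ()

record IsPartition (n : ℕ) (l : List ℕ) : Set where
  field
    sum≡     : sum l ≡ n
    sorted   : Sorted l
    positive : All (0 <_) l

nonincreasing⇒sorted : ∀ l → T (nonincreasing l) → Sorted l
nonincreasing⇒sorted []          _ = []
nonincreasing⇒sorted (x ∷ [])    _ = [-]
nonincreasing⇒sorted (x ∷ y ∷ l) t =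
  ≤ᵇ⇒≤ y x (proj₁ (Equivalence.to T-∧ t)) ∷ nonincreasing⇒sorted (y ∷ l) (proj₂ (Equivalence.to T-∧ t))

sorted⇒nonincreasing : ∀ {l} → Sorted l → T (nonincreasing l)
sorted⇒nonincreasing []           = _
sorted⇒nonincreasing [-]          = _
sorted⇒nonincreasing (y≤x ∷ rest) = Equivalence.from T-∧ (≤⇒≤ᵇ y≤x , sorted⇒nonincreasing rest)

∈⇒≤sum : ∀ {x l} → x ∈ l → x ≤ sum l
∈⇒≤sum {l = y ∷ l} (here refl) = m≤m+n y (sum l)
∈⇒≤sum {l = y ∷ l} (there x∈)  = ≤-trans (∈⇒≤sum x∈) (m≤n+m (sum l) y)

length≤sum : ∀ {l} → All (0 <_) l → length l ≤ sum l
length≤sum []          = z≤n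
length≤sum (x>0 ∷ l>0) = +-mono-≤ x>0 (length≤sum l>0)

∈-partitions⁺ : ∀ {n l} → IsPartition n l → l ∈ partitions n
∈-partitions⁺ {n} {l} record { sum≡ = refl ; sorted = l↗ ; positive = l>0 } =
  ∈-filter⁺ (T? ∘ λ l → (sum l ≡ᵇ n) ∧ nonincreasing l)
    (∈-boundedLists⁺ (length≤sum l>0) (All.zip (l>0 , All.tabulate ∈⇒≤sum)))
    (Equivalence.from T-∧ (≡⇒≡ᵇ (sum l) n refl , sorted⇒nonincreasing l↗))

∈-partitions⁻ : ∀ {n l} → l ∈ partitions n → IsPartition n l
∈-partitions⁻ {n} {l} l∈
  with l∈′ , t ← ∈-filter⁻ (T? ∘ λ l → (sum l ≡ᵇ n) ∧ nonincreasing l) {xs = boundedLists n n} l∈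
  with sum≡n , ni ← Equivalence.to T-∧ t = record
  { sum≡     = ≡ᵇ⇒≡ (sum l) n sum≡n
  ; sorted   = nonincreasing⇒sorted l ni
  ; positive = ∈-boundedLists⁻ l∈′
  }

partitions-unique : ∀ n → Unique (partitions n)
partitions-unique n = Unique.filter⁺ _ (boundedLists-unique n n)

insert-partition : ∀ {v m l} → 0 < v → IsPartition m l → IsPartition (v + m) (insert v l)
insert-partition {v} {l = l} v>0 record { sum≡ = refl ; sorted = l↗ ; positive = l>0 } = record
  { sum≡     = sum-↭ (insert-↭ v l)
  ; sorted   = insert-↗ v l↗
  ; positive = All-resp-↭ (↭-sym (insert-↭ v l)) (v>0 ∷ l>0)
  }

sorted-↭⇒≡ : ∀ {xs ys} → Sorted xs → Sorted ys → xs ↭ ys → xs ≡ ys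
sorted-↭⇒≡ xs↗ ys↗ xs↭ys = Pointwise-≡⇒≡ (↗↭↗⇒≋ ≥-totalOrder xs↗ ys↗ (↭⇒↭ₛ xs↭ys))

∈⇒↭∷ : ∀ {A : Set} {v : A} {xs} → v ∈ xs → ∃[ ys ] xs ↭ v ∷ ys
∈⇒↭∷ v∈xs with ys , zs , refl ← ∈-∃++ v∈xs = ys ++ zs , shift _ ys zs

map-unique : ∀ {A B : Set} {f : A → B} {xs} → Unique xs →
             (∀ {x y} → x ∈ xs → y ∈ xs → f x ≡ f y → x ≡ y) → Unique (map f xs)
map-unique []         _   = []
map-unique (x∉ ∷ xs!) inj =
  All.map⁺ (All.tabulate (λ y∈ fx≡fy → All.lookup x∉ y∈ (inj (here refl) (there y∈) fx≡fy)))
  ∷ map-unique xs! (λ x∈ y∈ → inj (there x∈) (there y∈))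

same-members⇒same-length : ∀ {A : Set} {xs ys : List A} → Unique xs → Unique ys →
                           (∀ {z} → z ∈ xs ⇔ z ∈ ys) → length xs ≡ length ys
same-members⇒same-length xs! ys! xs≈ys = ↭-length (∼bag⇒↭ (unique∧set⇒bag xs! ys! xs≈ys))

length-filterᵇ-split : ∀ {A : Set} (Q c : A → Bool) xs → length (filterᵇ Q xs) ≡
  length (filterᵇ (λ x → Q x ∧ not (c x)) xs) + length (filterᵇ (λ x → Q x ∧ c x) xs)
length-filterᵇ-split Q c [] = refl
length-filterᵇ-split Q c (x ∷ xs) with Q x | c x
... | true  | true  = trans (cong suc (length-filterᵇ-split Q c xs)) (sym (+-suc _ _))
... | true  | false = cong suc (length-filterᵇ-split Q c xs)
... | false | _     = length-filterᵇ-split Q c xs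

≡ᵇ-refl : ∀ n → (n ≡ᵇ n) ≡ true
≡ᵇ-refl zero    = refl
≡ᵇ-refl (suc n) = ≡ᵇ-refl n

≢⇒≡ᵇ-false : ∀ {m n} → m ≢ n → (m ≡ᵇ n) ≡ false
≢⇒≡ᵇ-false {zero}  {zero}  m≢n = contradiction refl m≢n
≢⇒≡ᵇ-false {zero}  {suc n} _   = refl
≢⇒≡ᵇ-false {suc m} {zero}  _   = refl
≢⇒≡ᵇ-false {suc m} {suc n} m≢n = ≢⇒≡ᵇ-false (m≢n ∘ cong suc)

∧-swapʳ : ∀ a b c → (a ∧ b) ∧ c ≡ (a ∧ c) ∧ b
∧-swapʳ a b c = trans (∧-assoc a b c) (trans (cong (a ∧_) (∧-comm b c)) (sym (∧-assoc a c b)))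

∧-cong-if : ∀ a {b c} → (T a → b ≡ c) → a ∧ b ≡ a ∧ c
∧-cong-if true  b≡c = b≡c _
∧-cong-if false _   = refl

memᵇ⁻ : ∀ {v l} → T (memᵇ v l) → v ∈ l
memᵇ⁻ {v} {l} t = Any.map (≡ᵇ⇒≡ v _) (any⁻ (v ≡ᵇ_) l t)

memᵇ⁺ : ∀ {v l} → v ∈ l → T (memᵇ v l)
memᵇ⁺ {v} v∈l = any⁺ (v ≡ᵇ_) (Any.map (≡⇒≡ᵇ v _) v∈l)

and-↭ : and Preserves _↭_ ⟶ _≡_
and-↭ p = foldr-commMonoid ∧.setoid ∧.isCommutativeMonoid (↭⇒↭ₛ p)
  where module ∧ = CommutativeMonoid ∧-commutativeMonoid

all-↭ : ∀ (A : ℕ → Bool) → all A Preserves _↭_ ⟶ _≡_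
all-↭ A = and-↭ ∘ map⁺ A

all-cong : ∀ {A A′ : ℕ → Bool} → A ≗ A′ → all A ≗ all A′
all-cong A≗A′ = cong and ∘ map-cong A≗A′

all-∷-true : ∀ {A : ℕ → Bool} {x} l → A x ≡ true → all A (x ∷ l) ≡ all A l
all-∷-true l Ax rewrite Ax = refl

countPart-↭ : ∀ a → countPart a Preserves _↭_ ⟶ _≡_
countPart-↭ a = ↭-length ∘ filter-↭ (T? ∘ (_≡ᵇ a))

countPart-∷-≡ : ∀ a l → countPart a (a ∷ l) ≡ suc (countPart a l)
countPart-∷-≡ a l rewrite ≡ᵇ-refl a = refl

countPart-∷-≢ : ∀ {a x} l → x ≢ a → countPart a (x ∷ l) ≡ countPart a l
countPart-∷-≢ l x≢a rewrite ≢⇒≡ᵇ-false x≢a = refl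

countPart-absent : ∀ {a l} → (∀ {x} → x ∈ l → x ≢ a) → countPart a l ≡ 0
countPart-absent {a} absent = cong length (filter-none (T? ∘ (_≡ᵇ a)) (All.tabulate λ x∈ t → absent x∈ (≡ᵇ⇒≡ _ a t)))

#partitions : (List ℕ → Bool) → ℕ → ℕ
#partitions Q n = length (filterᵇ Q (partitions n))

module _ (Q : List ℕ → Bool) (n : ℕ) where

  ∈-counted⁺ : ∀ {l} → IsPartition n l → T (Q l) → l ∈ filterᵇ Q (partitions n)
  ∈-counted⁺ l⊢n q = ∈-filter⁺ (T? ∘ Q) (∈-partitions⁺ l⊢n) q

  ∈-counted⁻ : ∀ {l} → l ∈ filterᵇ Q (partitions n) → IsPartition n l × T (Q l)
  ∈-counted⁻ l∈ with l∈′ , q ← ∈-filter⁻ (T? ∘ Q) {xs = partitions n} l∈ = ∈-partitions⁻ l∈′ , q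

  counted-unique : Unique (filterᵇ Q (partitions n))
  counted-unique = Unique.filter⁺ (T? ∘ Q) (partitions-unique n)

#partitions-cong : ∀ {Q Q′} → (∀ l → Q l ≡ Q′ l) → ∀ n → #partitions Q n ≡ #partitions Q′ n
#partitions-cong {Q} {Q′} Q≗Q′ n = cong length
  (filter-≐ (T? ∘ Q) (T? ∘ Q′) ((λ {l} → subst T (Q≗Q′ l)) , (λ {l} → subst T (sym (Q≗Q′ l)))) (partitions n))

#partitions-split : ∀ Q c n → #partitions Q n ≡ #partitions (λ l → Q l ∧ not (c l)) n + #partitions (λ l → Q l ∧ c l) n
#partitions-split Q c n = length-filterᵇ-split Q c (partitions n)

#partitions-none : ∀ (Q : List ℕ → Bool) {n} → (∀ {l} → IsPartition n l → ¬ T (Q l)) → #partitions Q n ≡ 0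
#partitions-none Q none = cong length (filter-none (T? ∘ Q) (All.tabulate (none ∘ ∈-partitions⁻)))

#partitions-containing-small : ∀ {Q : List ℕ → Bool} {v n} → n < v → #partitions (λ l → Q l ∧ memᵇ v l) n ≡ 0
#partitions-containing-small {Q} {v} n<v = #partitions-none _ λ {l} l⊢n t →
  <⇒≱ n<v (subst (v ≤_) (IsPartition.sum≡ l⊢n) (∈⇒≤sum (memᵇ⁻ {v} {l} (proj₂ (Equivalence.to (T-∧ {Q l}) t)))))

-- Inserting the part v is a bijection from the partitions of m onto those of v + m containing v.
#partitions-containing : ∀ {Q : List ℕ → Bool} {v m} → 0 < v → Q Preserves _↭_ ⟶ _≡_ →
                         #partitions (λ l → Q l ∧ memᵇ v l) (v + m) ≡ #partitions (λ l → Q (v ∷ l)) m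
#partitions-containing {Q} {v} {m} v>0 Q-↭ = sym (begin
  length L                  ≡⟨ sym (length-map (insert v) L) ⟩
  length (map (insert v) L) ≡⟨ same-members⇒same-length (map-unique (counted-unique _ m) insert-injective)
                                                         (counted-unique _ (v + m)) (mk⇔ to from) ⟩
  #partitions (λ l → Q l ∧ memᵇ v l) (v + m) ∎)
  where
  open ≡-Reasoning
  L = filterᵇ (λ l → Q (v ∷ l)) (partitions m)

  insert-injective : ∀ {l l′} → l ∈ L → l′ ∈ L → insert v l ≡ insert v l′ → l ≡ l′
  insert-injective {l} {l′} l∈ l′∈ eq = sorted-↭⇒≡
    (IsPartition.sorted (proj₁ (∈-counted⁻ _ m l∈))) (IsPartition.sorted (proj₁ (∈-counted⁻ _ m l′∈)))
    (drop-∷ (↭-trans (↭-sym (insert-↭ v l)) (subst (_↭ v ∷ l′) (sym eq) (insert-↭ v l′))))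

  to : ∀ {z} → z ∈ map (insert v) L → z ∈ filterᵇ (λ l → Q l ∧ memᵇ v l) (partitions (v + m))
  to z∈ with l , l∈ , refl ← ∈-map⁻ (insert v) z∈ with l⊢m , q ← ∈-counted⁻ _ m l∈ =
    ∈-counted⁺ _ (v + m) (insert-partition v>0 l⊢m) (Equivalence.from T-∧
      ( subst T (sym (Q-↭ (insert-↭ v l))) q
      , memᵇ⁺ (∈-resp-↭ (↭-sym (insert-↭ v l)) (here refl))))

  from : ∀ {z} → z ∈ filterᵇ (λ l → Q l ∧ memᵇ v l) (partitions (v + m)) → z ∈ map (insert v) L
  from {z} z∈ with z⊢v+m , t ← ∈-counted⁻ _ (v + m) z∈
              with qz , v∈z ← Equivalence.to T-∧ t
              with rest , z↭v∷rest ← ∈⇒↭∷ (memᵇ⁻ v∈z) =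
    subst (_∈ map (insert v) L) insert≡z (∈-map⁺ (insert v) (∈-counted⁺ _ m l⊢m (subst T (Q-↭ z↭v∷l) qz)))
    where
    l = sort rest
    z↭v∷l : z ↭ v ∷ l
    z↭v∷l = ↭-trans z↭v∷rest (prep v (↭-sym (sort-↭ rest)))
    insert≡z : insert v l ≡ z
    insert≡z = sorted-↭⇒≡ (insert-↗ v (sort-↗ rest)) (IsPartition.sorted z⊢v+m)
                          (↭-trans (insert-↭ v l) (↭-sym z↭v∷l))
    l⊢m : IsPartition m l
    l⊢m = record
      { sum≡     = +-cancelˡ-≡ v _ _ (trans (sym (sum-↭ z↭v∷l)) (IsPartition.sum≡ z⊢v+m))
      ; sorted   = sort-↗ rest
      ; positive = All.tail (All-resp-↭ z↭v∷l (IsPartition.positive z⊢v+m))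
      }

module _ (Q : List ℕ → Bool) {v : ℕ} where

  #partitions-small : ∀ {n} → n < v → #partitions Q n ≡ #partitions (λ l → Q l ∧ not (memᵇ v l)) n
  #partitions-small {n} n<v = begin
    #partitions Q n                                          ≡⟨ #partitions-split Q (memᵇ v) n ⟩
    #partitions Q∖v n + #partitions (λ l → Q l ∧ memᵇ v l) n ≡⟨ cong (#partitions Q∖v n +_)
                                                                    (#partitions-containing-small n<v) ⟩
    #partitions Q∖v n + 0                                    ≡⟨ +-identityʳ _ ⟩
    #partitions Q∖v n                                        ∎
    where
    open ≡-Reasoning
    Q∖v = λ l → Q l ∧ not (memᵇ v l)

  #partitions-remove-part : ∀ {m} → 0 < v → Q Preserves _↭_ ⟶ _≡_ →
    #partitions Q (v + m) ≡ #partitions (λ l → Q l ∧ not (memᵇ v l)) (v + m) + #partitions (λ l → Q (v ∷ l)) m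
  #partitions-remove-part {m} v>0 Q-↭ = trans (#partitions-split Q (memᵇ v) (v + m))
    (cong (#partitions (λ l → Q l ∧ not (memᵇ v l)) (v + m) +_) (#partitions-containing v>0 Q-↭))

  #partitions-strideSum : ∀ {Q′} → 0 < v → Q Preserves _↭_ ⟶ _≡_ → (∀ l → Q (v ∷ l) ≡ Q l) →
                          (∀ l → Q l ∧ not (memᵇ v l) ≡ Q′ l) → StrideSum _≡_ v (#partitions Q′) (#partitions Q)
  #partitions-strideSum v>0 Q-↭ Q-∷ Q∖v≗Q′ = record
    { initial = λ n n<v → trans (#partitions-small n<v) (#partitions-cong Q∖v≗Q′ n)
    ; step    = λ n → trans (#partitions-remove-part v>0 Q-↭)
                          (cong₂ _+_ (#partitions-cong Q∖v≗Q′ (v + n)) (#partitions-cong Q-∷ n))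
    }

_◃_ : ℕ → (ℕ → Bool) → ℕ → Bool
(v ◃ A) x = (x ≡ᵇ v) ∨ A x

∅ : ℕ → Bool
∅ _ = false

◃-self : ∀ v A → (v ◃ A) v ≡ true
◃-self v A rewrite ≡ᵇ-refl v = refl

◃-other : ∀ {v A x} → x ≢ v → (v ◃ A) x ≡ A x
◃-other x≢v rewrite ≢⇒≡ᵇ-false x≢v = refl

◃-absorb : ∀ {v A} → A v ≡ true → (v ◃ A) ≗ A
◃-absorb {v} {A} Av x with x ≟ v
... | yes refl = trans (◃-self x A) (sym Av)
... | no  x≢v  = ◃-other {A = A} x≢v

all-◃-without : ∀ {A v} → A v ≡ false → ∀ l → all (v ◃ A) l ∧ not (memᵇ v l) ≡ all A l
all-◃-without Av [] = refl
all-◃-without {A} {v} Av (x ∷ l) with x ≟ v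
... | yes refl rewrite ≡ᵇ-refl x | Av = ∧-zeroʳ _
... | no  x≢v  rewrite ≢⇒≡ᵇ-false x≢v | ≢⇒≡ᵇ-false (x≢v ∘ sym) =
  trans (∧-assoc (A x) _ _) (cong (A x ∧_) (all-◃-without Av l))

#partitionsInto : (ℕ → Bool) → (List ℕ → Bool) → ℕ → ℕ
#partitionsInto A ψ = #partitions (λ l → all A l ∧ ψ l)

#partitionsInto-cong : ∀ {A A′} → A ≗ A′ → ∀ ψ n → #partitionsInto A ψ n ≡ #partitionsInto A′ ψ n
#partitionsInto-cong A≗A′ ψ = #partitions-cong (λ l → cong (_∧ ψ l) (all-cong A≗A′ l))

#partitionsInto-◃ : ∀ {A ψ v} → 0 < v → A v ≡ false → ψ Preserves _↭_ ⟶ _≡_ → (∀ l → ψ (v ∷ l) ≡ ψ l) →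
                    StrideSum _≡_ v (#partitionsInto A ψ) (#partitionsInto (v ◃ A) ψ)
#partitionsInto-◃ {A} {ψ} {v} v>0 Av ψ-↭ ψ-∷ = #partitions-strideSum (λ l → all (v ◃ A) l ∧ ψ l) v>0
  (λ p → cong₂ _∧_ (all-↭ (v ◃ A) p) (ψ-↭ p))
  (λ l → cong₂ _∧_ (all-∷-true {v ◃ A} l (◃-self v A)) (ψ-∷ l))
  (λ l → trans (∧-swapʳ (all (v ◃ A) l) (ψ l) _) (cong (_∧ ψ l) (all-◃-without Av l)))

∣[p+q]b-qa∣≡∣pa-[p+q]c∣ : ∀ p q {a b c} → a ≡ c + b → ∣ (p + q) * b - q * a ∣ ≡ ∣ p * a - (p + q) * c ∣
∣[p+q]b-qa∣≡∣pa-[p+q]c∣ p q {a} {b} {c} a≡c+b = begin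
  ∣ (p + q) * b - q * a ∣                               ≡⟨ sym (∣m+n-m+o∣≡∣n-o∣ ((p + q) * c) ((p + q) * b) (q * a)) ⟩
  ∣ (p + q) * c + (p + q) * b - (p + q) * c + q * a ∣   ≡⟨ cong₂ ∣_-_∣ split (+-comm ((p + q) * c) (q * a)) ⟩
  ∣ q * a + p * a - q * a + (p + q) * c ∣               ≡⟨ ∣m+n-m+o∣≡∣n-o∣ (q * a) (p * a) ((p + q) * c) ⟩
  ∣ p * a - (p + q) * c ∣                               ∎
  where
  open ≡-Reasoning
  split : (p + q) * c + (p + q) * b ≡ q * a + p * a
  split = begin
    (p + q) * c + (p + q) * b   ≡⟨ sym (*-distribˡ-+ (p + q) c b) ⟩
    (p + q) * (c + b)           ≡⟨ cong ((p + q) *_) (sym a≡c+b) ⟩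
    (p + q) * a                 ≡⟨ *-distribʳ-+ a p q ⟩
    p * a + q * a               ≡⟨ +-comm (p * a) (q * a) ⟩
    q * a + p * a               ∎

-- Partitions into parts r, s and further parts

module _ {r s : ℕ} (r>0 : 0 < r) (s>0 : 0 < s) (r≢s : r ≢ s) where

  #r>#s : List ℕ → Bool
  #r>#s l = countPart s l <ᵇ countPart r l

  #r>#s-↭ : #r>#s Preserves _↭_ ⟶ _≡_
  #r>#s-↭ p = cong₂ _<ᵇ_ (countPart-↭ s p) (countPart-↭ r p)

  pTotal pMoreR : (ℕ → Bool) → ℕ → ℕ
  pTotal A = #partitionsInto A (λ _ → true)
  pMoreR A = #partitionsInto A #r>#s

  ratio-◃ : ∀ {A v} → 0 < v → v ≢ r → v ≢ s → A v ≡ false →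
            RatioTendsTo s (r + s) (pMoreR A) (pTotal A) → RatioTendsTo s (r + s) (pMoreR (v ◃ A)) (pTotal (v ◃ A))
  ratio-◃ v>0 v≢r v≢s Av = ratio-strideSum v>0
    (#partitionsInto-◃ v>0 Av #r>#s-↭ (λ l → cong₂ _<ᵇ_ (countPart-∷-≢ l v≢s) (countPart-∷-≢ l v≢r)))
    (#partitionsInto-◃ v>0 Av (λ _ → refl) (λ _ → refl))

  private
    instance
      r≢0 : NonZero r
      r≢0 = >-nonZero r>0
      s≢0 : NonZero s
      s≢0 = >-nonZero s>0
      r+s≢0 : NonZero (r + s)
      r+s≢0 = >-nonZero (≤-trans r>0 (m≤m+n r s))
      P≢0 : NonZero ((r + s) * (s * r))
      P≢0 = m*n≢0 (r + s) (s * r) {{r+s≢0}} {{m*n≢0 s r}}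

  R∪S : ℕ → Bool
  R∪S = r ◃ (s ◃ ∅)

  notMoreR moreS : List ℕ → Bool
  notMoreR l = all R∪S l ∧ not (#r>#s l)
  moreS    l = all R∪S l ∧ not (countPart s l <ᵇ suc (countPart r l))

  pOnlyS pNotMoreR pMoreS : ℕ → ℕ
  pOnlyS    = pTotal (s ◃ ∅)
  pNotMoreR = #partitions notMoreR
  pMoreS    = #partitions moreS

  pTotal∅-positive : ∀ {n} → 0 < n → pTotal ∅ n ≡ 0
  pTotal∅-positive {n} n>0 = #partitions-none _ no-parts
    where
    no-parts : ∀ {l} → IsPartition n l → ¬ T (all ∅ l ∧ true)
    no-parts {[]}    l⊢n = contradiction (IsPartition.sum≡ l⊢n) (<⇒≢ n>0)
    no-parts {_ ∷ _} _   = λ ()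

  pOnlyS-indicates-multiples : IndicatesMultiples s pOnlyS
  pOnlyS-indicates-multiples = stride-induction _ s>0 initial step
    where
    pOnlyS≡Σ : StrideSum _≡_ s (pTotal ∅) pOnlyS
    pOnlyS≡Σ = #partitionsInto-◃ s>0 refl (λ _ → refl) (λ _ → refl)
    initial : ∀ n → n < s → (s ∣ n → pOnlyS n ≡ 1) × (s ∤ n → pOnlyS n ≡ 0)
    initial zero    _   = (λ _ → refl) , (λ s∤0 → contradiction (s ∣0) s∤0)
    initial (suc n) n<s = (λ s∣n → contradiction (∣⇒≤ s∣n) (<⇒≱ n<s)) ,
                          (λ _ → trans (StrideSum.initial pOnlyS≡Σ (suc n) n<s) (pTotal∅-positive {suc n} z<s))
    step : ∀ n → (s ∣ n → pOnlyS n ≡ 1) × (s ∤ n → pOnlyS n ≡ 0) →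
                 (s ∣ s + n → pOnlyS (s + n) ≡ 1) × (s ∤ s + n → pOnlyS (s + n) ≡ 0)
    step n (multiple , nonmultiple) =
      (λ s∣s+n → trans shifted (multiple (∣m+n∣m⇒∣n s∣s+n ∣-refl))) ,
      (λ s∤s+n → trans shifted (nonmultiple (s∤s+n ∘ ∣m∣n⇒∣m+n ∣-refl)))
      where
      shifted : pOnlyS (s + n) ≡ pOnlyS n
      shifted = trans (StrideSum.step pOnlyS≡Σ n)
                      (cong (_+ pOnlyS n) (pTotal∅-positive (≤-trans s>0 (m≤m+n s n))))

  private
    only-s : ∀ {l x} → T (all (s ◃ ∅) l) → x ∈ l → x ≡ s
    only-s {l} t x∈l = ≡ᵇ⇒≡ _ s (subst T (∨-identityʳ _) (All.lookup (All.all⁺ (s ◃ ∅) l t) x∈l))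

    notMoreR-without-r : ∀ l → notMoreR l ∧ not (memᵇ r l) ≡ all (s ◃ ∅) l ∧ true
    notMoreR-without-r l = begin
      (all R∪S l ∧ not (#r>#s l)) ∧ not (memᵇ r l)   ≡⟨ ∧-swapʳ (all R∪S l) _ _ ⟩
      (all R∪S l ∧ not (memᵇ r l)) ∧ not (#r>#s l)   ≡⟨ cong (_∧ not (#r>#s l)) (all-◃-without (◃-other r≢s) l) ⟩
      all (s ◃ ∅) l ∧ not (#r>#s l)                  ≡⟨ ∧-cong-if (all (s ◃ ∅) l) no-r ⟩
      all (s ◃ ∅) l ∧ true                           ∎
      where
      open ≡-Reasoning
      no-r : T (all (s ◃ ∅) l) → not (#r>#s l) ≡ true
      no-r t rewrite countPart-absent {r} {l} λ x∈l x≡r → r≢s (trans (sym x≡r) (only-s t x∈l)) = refl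

    moreS-without-s : ∀ l → moreS l ∧ not (memᵇ s l) ≡ false
    moreS-without-s l with memᵇ s l in s∈?
    ... | true  = ∧-zeroʳ _
    ... | false rewrite countPart-absent {s} {l} (λ x∈l x≡s → subst T s∈? (memᵇ⁺ (subst (_∈ l) x≡s x∈l))) =
      cong (_∧ true) (∧-zeroʳ _)

    pNotMoreR-small : ∀ {n} → n < r → pNotMoreR n ≡ pOnlyS n
    pNotMoreR-small {n} n<r = trans (#partitions-small notMoreR n<r) (#partitions-cong notMoreR-without-r n)

    pNotMoreR-remove-r : ∀ m → pNotMoreR (r + m) ≡ pOnlyS (r + m) + pMoreS m
    pNotMoreR-remove-r m = trans (#partitions-remove-part notMoreR r>0 notMoreR-↭)
      (cong₂ _+_ (#partitions-cong notMoreR-without-r (r + m)) (#partitions-cong with-r m))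
      where
      notMoreR-↭ : notMoreR Preserves _↭_ ⟶ _≡_
      notMoreR-↭ p = cong₂ _∧_ (all-↭ R∪S p) (cong not (#r>#s-↭ p))
      with-r : ∀ l → notMoreR (r ∷ l) ≡ moreS l
      with-r l = cong₂ _∧_ (all-∷-true {R∪S} {r} l (◃-self r (s ◃ ∅)))
                           (cong not (cong₂ _<ᵇ_ (countPart-∷-≢ l r≢s) (countPart-∷-≡ r l)))

    none-without-s : ∀ m → #partitions (λ l → moreS l ∧ not (memᵇ s l)) m ≡ 0
    none-without-s m = trans (#partitions-cong moreS-without-s m) (#partitions-none (λ _ → false) {m} λ _ ())

    pMoreS-small : ∀ {m} → m < s → pMoreS m ≡ 0
    pMoreS-small {m} m<s = trans (#partitions-small moreS m<s) (none-without-s m)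

    pMoreS-remove-s : ∀ m → pMoreS (s + m) ≡ pNotMoreR m
    pMoreS-remove-s m = trans (#partitions-remove-part moreS s>0 moreS-↭)
      (cong₂ _+_ (none-without-s (s + m)) (#partitions-cong with-s m))
      where
      moreS-↭ : moreS Preserves _↭_ ⟶ _≡_
      moreS-↭ p = cong₂ _∧_ (all-↭ R∪S p) (cong not (cong₂ _<ᵇ_ (countPart-↭ s p) (cong suc (countPart-↭ r p))))
      with-s : ∀ l → moreS (s ∷ l) ≡ notMoreR l
      with-s l = cong₂ _∧_ (all-∷-true {R∪S} {s} l (trans (◃-other {A = s ◃ ∅} (r≢s ∘ sym)) (◃-self s ∅)))
                           (cong not (cong₂ _<ᵇ_ (countPart-∷-≡ s l) (cong suc (countPart-∷-≢ l (r≢s ∘ sym)))))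

  -- Partitions of n with at least one r and #r ≤ #s correspond, by removing one r and one s,
  -- to those of n - (r + s) with #r ≤ #s.
  pNotMoreR≡Σ : StrideSum _≡_ (r + s) pOnlyS pNotMoreR
  pNotMoreR≡Σ = record { initial = initial ; step = step }
    where
    open ≡-Reasoning
    initial : ∀ n → n < r + s → pNotMoreR n ≡ pOnlyS n
    initial n n<r+s with n <? r
    ... | yes n<r = pNotMoreR-small n<r
    ... | no  n≮r = subst (λ n → pNotMoreR n ≡ pOnlyS n) r+m≡n (begin
      pNotMoreR (r + m)            ≡⟨ pNotMoreR-remove-r m ⟩
      pOnlyS (r + m) + pMoreS m    ≡⟨ cong (pOnlyS (r + m) +_) (pMoreS-small m<s) ⟩
      pOnlyS (r + m) + 0           ≡⟨ +-identityʳ _ ⟩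
      pOnlyS (r + m)               ∎)
      where
      m = n ∸ r
      r+m≡n = m+[n∸m]≡n (≮⇒≥ n≮r)
      m<s = +-cancelˡ-< r m s (subst (_< r + s) (sym r+m≡n) n<r+s)
    step : ∀ n → pNotMoreR (r + s + n) ≡ pOnlyS (r + s + n) + pNotMoreR n
    step n = begin
      pNotMoreR (r + s + n)                ≡⟨ cong pNotMoreR (+-assoc r s n) ⟩
      pNotMoreR (r + (s + n))              ≡⟨ pNotMoreR-remove-r (s + n) ⟩
      pOnlyS (r + (s + n)) + pMoreS (s + n) ≡⟨ cong₂ _+_ (cong pOnlyS (sym (+-assoc r s n))) (pMoreS-remove-s n) ⟩
      pOnlyS (r + s + n) + pNotMoreR n     ∎

  module _ (coprime : Coprime r s) where

    pTotal-period : ∀ t n → pTotal R∪S (t * (s * r) + n) ≡ t + pTotal R∪S n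
    pTotal-period = strideSum-period (Coprime.sym coprime) pOnlyS-indicates-multiples
      (#partitionsInto-◃ r>0 (◃-other r≢s) (λ _ → refl) (λ _ → refl))

    pNotMoreR-period : ∀ t n → pNotMoreR (t * (s * (r + s)) + n) ≡ t + pNotMoreR n
    pNotMoreR-period = strideSum-period (Coprime.sym (subst (λ m → Coprime m s) (+-comm s r) (coprime-+ coprime)))
      pOnlyS-indicates-multiples pNotMoreR≡Σ

    error-bounded : ∃[ B ] (∀ n → ∣ (r + s) * pMoreR R∪S n - s * pTotal R∪S n ∣ ≤ B)
    error-bounded = map₂ (λ {B} E≤B n → subst (_≤ B) (sym (error≡E n)) (E≤B n)) (periodic⇒bounded P E E-periodic)
      where
      P = (r + s) * (s * r)
      E : ℕ → ℕ
      E n = ∣ r * pTotal R∪S n - (r + s) * pNotMoreR n ∣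
      E-periodic : ∀ n → E (P + n) ≡ E n
      E-periodic = ∣-∣-periodic r (r + s) (pTotal R∪S) pNotMoreR {P} (pTotal-period (r + s))
        (λ n → trans (cong (λ m → pNotMoreR (m + n)) (solve 2 (λ r s → (r :+ s) :* (s :* r) := r :* (s :* (r :+ s))) refl r s))
                     (pNotMoreR-period r n))
        (*-comm r (r + s))
      error≡E : ∀ n → ∣ (r + s) * pMoreR R∪S n - s * pTotal R∪S n ∣ ≡ E n
      error≡E n = ∣[p+q]b-qa∣≡∣pa-[p+q]c∣ r s (trans (#partitions-split _ #r>#s n) (cong₂ _+_
        (#partitions-cong (λ l → cong (_∧ not (#r>#s l)) (∧-identityʳ _)) n)
        (#partitions-cong (λ l → cong (_∧ #r>#s l) (∧-identityʳ _)) n)))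

    ratio-R∪S : RatioTendsTo s (r + s) (pMoreR R∪S) (pTotal R∪S)
    ratio-R∪S = bounded⇒negligible (proj₂ error-bounded) Z→∞ , Z→∞
      where
      Z→∞ : Unbounded (λ n → (r + s) * pTotal R∪S n)
      Z→∞ = unbounded-mono (λ n → m≤n*m (pTotal R∪S n) (r + s)) (quasiperiodic⇒unbounded {f = pTotal R∪S} pTotal-period)

  -- all (R∪S∪I I) is definitionally allowed r s I.
  R∪S∪I : List ℕ → ℕ → Bool
  R∪S∪I I = r ◃ (s ◃ λ x → memᵇ x I)

  R∪S∪I-∷ : ∀ v I → R∪S∪I (v ∷ I) ≗ v ◃ R∪S∪I I
  R∪S∪I-∷ v I x = trans (cong ((x ≡ᵇ r) ∨_) (x∙yz≈y∙xz (x ≡ᵇ s) (x ≡ᵇ v) _))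
                        (x∙yz≈y∙xz (x ≡ᵇ r) (x ≡ᵇ v) _)

  ratio-resp-≗ : ∀ {A A′} → A ≗ A′ →
                 RatioTendsTo s (r + s) (pMoreR A) (pTotal A) → RatioTendsTo s (r + s) (pMoreR A′) (pTotal A′)
  ratio-resp-≗ A≗A′ = ratio-cong (#partitionsInto-cong A≗A′ _) (#partitionsInto-cong A≗A′ _)

  ratio-R∪S∪I : Coprime r s → ∀ I → All (λ i → 0 < i × i ≢ r × i ≢ s) I →
                RatioTendsTo s (r + s) (pMoreR (R∪S∪I I)) (pTotal (R∪S∪I I))
  ratio-R∪S∪I coprime []      []                          = ratio-R∪S coprime
  ratio-R∪S∪I coprime (v ∷ I) ((v>0 , v≢r , v≢s) ∷ valid) with R∪S∪I I v in v∈?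
  ... | true  = ratio-resp-≗ (λ x → sym (trans (R∪S∪I-∷ v I x) (◃-absorb v∈? x))) (ratio-R∪S∪I coprime I valid)
  ... | false = ratio-resp-≗ (sym ∘ R∪S∪I-∷ v I) (ratio-◃ v>0 v≢r v≢s v∈? (ratio-R∪S∪I coprime I valid))

corollary1 : (r s : ℕ) (I : List ℕ) → 0 < r → 0 < s → r ≢ s → gcd r s ≡ 1 →
    All (λ i → 0 < i × i ≢ r × i ≢ s) I →
    ∀ (k : ℕ) → ∃[ N ] (∀ (n : ℕ) → N ≤ n →
      suc k * ∣ (r + s) * pR>S r s I n - s * pRSI r s I n ∣ < (r + s) * pRSI r s I n)
corollary1 r s I r>0 s>0 r≢s gcd≡1 valid = ratio⇒eventually
  (ratio-cong (λ _ → refl) (#partitions-cong (λ _ → ∧-identityʳ _))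
    (ratio-R∪S∪I r>0 s>0 r≢s (gcd≡1⇒coprime gcd≡1) I valid))
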